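{- Let $A$ be an FDDS and $k>0$ an integer. If $A$ does not contain a dendron, then the monomial $X\mapsto AX^k$ is not injective on FDDSs.
   Context: An FDDS is a finite set with a total function on it, viewed as a functional digraph up to isomorphism. Product is the direct product of digraphs (vertex set $V(A)\times V(B)$, arc $(u,u')\to(v,v')$ iff $u\to v$ and $u'\to v'$); $X^k$ is the $k$-fold product. Each connected component of an FDDS contains exactly one cycle; a dendron is a connected FDDS whose cycle has length $1$. "$A$ contains a dendron" means some connected component of $A$ is a dendron. Not injective means there exist FDDSs $X\neq Y$ with $AX^k=AY^k$. -}

module Defs where

open import Data.Nat using (ℕ; zero; suc; _*_)
open import Data.Fin using (Fin; combine; remQuot)
open import Data.Product using (Σ; ∃; ∃-syntax; _×_; _,_; proj₁; proj₂)
open import Relation.Binary.PropositionalEquality using (_≡_)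
open import Function.Bundles using (_↔_; Inverse)
open import Relation.Nullary using (¬_)

iter : ∀ {n} → (Fin n → Fin n) → ℕ → Fin n → Fin n
iter f zero    x = x
iter f (suc i) x = f (iter f i x)

record FDDS : Set where
  constructor fdds
  field
    size : ℕ
    fun  : Fin size → Fin size
open FDDS public

_≅_ : FDDS → FDDS → Set
A ≅ B = Σ (Fin (size A) ↔ Fin (size B)) λ φ →
  ∀ x → Inverse.to φ (fun A x) ≡ fun B (Inverse.to φ x)

-- Direct product: states Fin (n * m) ≃ Fin n × Fin m, acting componentwise.
_⊗_ : FDDS → FDDS → FDDS
A ⊗ B = fdds (size A * size B) λ i →
  let p = remQuot (size B) i in
  combine (fun A (proj₁ p)) (fun B (proj₂ p))

𝟙 : FDDS
𝟙 = fdds 1 (λ x → x)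

_^_ : FDDS → ℕ → FDDS
X ^ zero  = 𝟙
X ^ suc k = X ⊗ (X ^ k)

SameComponent : (A : FDDS) → Fin (size A) → Fin (size A) → Set
SameComponent A x y = ∃[ i ] ∃[ j ] iter (fun A) i x ≡ iter (fun A) j y

-- A contains a dendron: some connected component (that of x) has a cycle of
-- length 1, i.e. contains a fixed point y.
ContainsDendron : FDDS → Set
ContainsDendron A = ∃[ x ] ∃[ y ] SameComponent A x y × fun A y ≡ y

MonomialNotInjective : FDDS → ℕ → Set
MonomialNotInjective A k =
  ∃[ X ] ∃[ Y ] (¬ (X ≅ Y) × ((A ⊗ (X ^ k)) ≅ (A ⊗ (Y ^ k))))

-- A family of bijections τₐ : X ↔ Y indexed by the states a of A is a twist if
-- τ_{f a} ∘ step_X = step_Y ∘ τₐ.  A twist gives A × X ≅ A × Y, (a , x) ↦ (a , τₐ x),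
-- and twists multiply, so then A X^k ≅ A Y^k for every k.
-- If the component of a has a cycle of length p, rotating the p-cycle Cₚ by the
-- distance from a to a chosen root of that cycle twists Cₚ into the p fixed
-- points Tₚ over the states with cycle length p.  A product of formal
-- differences vanishes (its two sides are twisted into each other) wherever one
-- factor does, so X − Y = (T₂ − C₂)(T₃ − C₃)⋯(T_N − C_N), with N bounding the
-- cycle lengths, vanishes over all of A, which has no cycle of length 1.
-- Exactly one of X, Y has a fixed point, so X ≇ Y.

module Submission where

open import Defs
open import Data.Nat using (ℕ; _>_)
open import Relation.Nullary using (¬_)

open import Level using (0ℓ)
open import Function.Base using (id; _∘_)
open import Data.Nat.Base using (zero; suc; pred; _+_; _*_; _∸_; _≤_; _<_; z≤n; s≤s; s≤s⁻¹; z<s; NonZero)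
open import Data.Nat.Properties
  using (≤-antisym; ≤-trans; ≤-<-trans; <⇒≤; +-assoc; +-comm; *-suc; suc-pred; +-∸-comm; m∸n+n≡m; m∸n≤m;
         m<n⇒0<n∸m; ∸-monoʳ-<; +-monoˡ-≤; m≤n⇒m<n∨m≡n; n≤0⇒n≡0; 1+n≢n; n<1+n)
  renaming (_≟_ to _≟ℕ_)
open import Data.Nat.DivMod using (_%_; _mod_; m%n<n; %-distribˡ-+; m%n%n≡m%n; [m+kn]%n≡m%n; n%n≡0; m<n⇒m%n≡m)
open import Data.Fin.Base using (Fin; toℕ)
open import Data.Fin.Properties using (_≟_; toℕ-injective; toℕ-fromℕ<; toℕ<n; toℕ≤pred[n]; pigeonhole; remQuot-combine; *↔×; +↔⊎)
open import Data.Product.Base as Product using (_×_; _,_; ∃-syntax)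
open import Data.Product.Properties using (,-injectiveˡ; ,-injectiveʳ)
open import Data.Product.Function.NonDependent.Propositional using (_×-↔_)
open import Data.Sum.Base as Sum using (_⊎_; inj₁; inj₂; fromInj₁)
open import Data.Sum.Properties using (inj₁-injective; inj₂-injective)
open import Data.Sum.Function.Propositional using (_⊎-↔_)
open import Data.Sum.Algebra using (⊎-comm)
open import Data.Unit.Base using (tt)
open import Data.List.Base using (List; applyUpTo)
open import Data.List.Relation.Unary.All.Properties using (applyUpTo⁺₁; applyUpTo⁻)
open import Data.List.Extrema.Nat using (argmin; argmin-all; f[argmin]≤f[xs])
open import Data.Bool.Base using (if_then_else_)
open import Relation.Nullary using (Dec; yes; no; does; contradiction)
open import Relation.Unary using (Pred; Decidable; _∪_; _⊆_; U)
open import Relation.Binary.PropositionalEquality using (_≡_; _≢_; refl; sym; trans; cong; cong₂; subst; module ≡-Reasoning)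
open import Function.Bundles using (_↔_; Inverse; mk↔ₛ′; _⇔_; mk⇔; Equivalence)
open import Function.Properties.Inverse using (↔-refl; ↔-sym; ↔-trans)

open Inverse using (to; from; strictlyInverseˡ; strictlyInverseʳ)
open ≡-Reasoning

-- Finite dynamical systems on arbitrary carriers, so that sums and products
-- need no index arithmetic; an enumeration of the carrier leads back to FDDS.
record System : Set₁ where
  field
    State : Set
    step  : State → State
    card  : ℕ
    enum  : State ↔ Fin card
open System

private
  variable
    A A′ C C′ : FDDS
    B W W′ X X′ Y Y′ Z : System

⟦_⟧ : FDDS → System
⟦ A ⟧ = record { State = Fin (size A) ; step = fun A ; card = size A ; enum = ↔-refl }

toFDDS : System → FDDS
toFDDS X = fdds (card X) (λ i → to (enum X) (step X (from (enum X) i)))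

infixr 7 _×ˢ_
infixr 6 _⊎ˢ_

_×ˢ_ : System → System → System
X ×ˢ Y = record
  { State = State X × State Y
  ; step  = Product.map (step X) (step Y)
  ; card  = card X * card Y
  ; enum  = ↔-trans (enum X ×-↔ enum Y) (↔-sym *↔×)
  }

_⊎ˢ_ : System → System → System
X ⊎ˢ Y = record
  { State = State X ⊎ State Y
  ; step  = Sum.map (step X) (step Y)
  ; card  = card X + card Y
  ; enum  = ↔-trans (enum X ⊎-↔ enum Y) (↔-sym +↔⊎)
  }

HasFixedPoint : System → Set
HasFixedPoint X = ∃[ x ] step X x ≡ x

infix 4 _≃_

record _≃_ (X Y : System) : Set where
  constructor mk≃
  field
    iso      : State X ↔ State Y
    iso-step : ∀ x → to iso (step X x) ≡ step Y (to iso x)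

≃⇒≅ : ⟦ A ⟧ ≃ ⟦ C ⟧ → A ≅ C
≃⇒≅ (mk≃ φ commutes) = φ , commutes

≅⇒≃ : A ≅ C → ⟦ A ⟧ ≃ ⟦ C ⟧
≅⇒≃ (φ , commutes) = mk≃ φ commutes

from-commutes : ∀ {S T : Set} {s : S → S} {t : T → T} (φ ψ : S ↔ T) →
                (∀ x → to ψ (s x) ≡ t (to φ x)) → ∀ y → from ψ (t y) ≡ s (from φ y)
from-commutes {s = s} {t} φ ψ commutes y = begin
  from ψ (t y)                  ≡⟨ cong (from ψ ∘ t) (strictlyInverseˡ φ y) ⟨
  from ψ (t (to φ (from φ y)))  ≡⟨ cong (from ψ) (commutes (from φ y)) ⟨
  from ψ (to ψ (s (from φ y)))  ≡⟨ strictlyInverseʳ ψ _ ⟩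
  s (from φ y)                  ∎

≃-sym : X ≃ Y → Y ≃ X
≃-sym (mk≃ φ commutes) = mk≃ (↔-sym φ) (from-commutes φ φ commutes)

≃-trans : X ≃ Y → Y ≃ Z → X ≃ Z
≃-trans (mk≃ φ φ-commutes) (mk≃ ψ ψ-commutes) =
  mk≃ (↔-trans φ ψ) λ x → trans (cong (to ψ) (φ-commutes x)) (ψ-commutes (to φ x))

≃-fixedPoint : X ≃ Y → HasFixedPoint X → HasFixedPoint Y
≃-fixedPoint (mk≃ φ commutes) (x , fixed) = to φ x , trans (sym (commutes x)) (cong (to φ) fixed)

⊎ˢ-comm : X ⊎ˢ Y ≃ Y ⊎ˢ X
⊎ˢ-comm = mk≃ (⊎-comm _ _) λ { (inj₁ x) → refl ; (inj₂ y) → refl }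

⊗≃×ˢ : ⟦ A ⊗ C ⟧ ≃ ⟦ A ⟧ ×ˢ ⟦ C ⟧
⊗≃×ˢ {A} {C} = mk≃ *↔× λ i → remQuot-combine (fun A _) (fun C _)

toFDDS-≃ : ⟦ toFDDS X ⟧ ≃ X
toFDDS-≃ {X} = mk≃ (↔-sym (enum X)) λ i → strictlyInverseʳ (enum X) (step X (from (enum X) i))

-- Twisted isomorphisms

record Twist (B : System) (P : Pred (State B) 0ℓ) (X Y : System) : Set where
  field
    fibre      : State B → State X ↔ State Y
    fibre-step : ∀ {a} → P a → ∀ x → to (fibre (step B a)) (step X x) ≡ step Y (to (fibre a) x)
open Twist

module _ {B : System} where
  private
    variable
      P Q : Pred (State B) 0ℓ

  twist-refl : Twist B P X X
  twist-refl = record { fibre = λ _ → ↔-refl ; fibre-step = λ _ _ → refl }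

  twist-sym : Twist B P X Y → Twist B P Y X
  twist-sym σ = record
    { fibre      = ↔-sym ∘ fibre σ
    ; fibre-step = λ {a} Pa → from-commutes (fibre σ a) (fibre σ (step B a)) (fibre-step σ Pa)
    }

  twist-trans : Twist B P X Y → Twist B P Y Z → Twist B P X Z
  twist-trans σ τ = record
    { fibre      = λ a → ↔-trans (fibre σ a) (fibre τ a)
    ; fibre-step = λ {a} Pa x →
        trans (cong (to (fibre τ (step B a))) (fibre-step σ Pa x)) (fibre-step τ Pa (to (fibre σ a) x))
    }

  ≃⇒twist : X ≃ Y → Twist B P X Y
  ≃⇒twist (mk≃ φ commutes) = record { fibre = λ _ → φ ; fibre-step = λ _ → commutes }

  twist-≃ : X′ ≃ X → Y′ ≃ Y → Twist B P X Y → Twist B P X′ Y′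
  twist-≃ X′≃X Y′≃Y σ = twist-trans (≃⇒twist X′≃X) (twist-trans σ (≃⇒twist (≃-sym Y′≃Y)))

  twist-× : Twist B P X Y → Twist B P W W′ → Twist B P (X ×ˢ W) (Y ×ˢ W′)
  twist-× σ τ = record
    { fibre      = λ a → fibre σ a ×-↔ fibre τ a
    ; fibre-step = λ Pa (x , u) → cong₂ _,_ (fibre-step σ Pa x) (fibre-step τ Pa u)
    }

  twist-⊎ : Twist B P X Y → Twist B P W W′ → Twist B P (X ⊎ˢ W) (Y ⊎ˢ W′)
  twist-⊎ σ τ = record
    { fibre      = λ a → fibre σ a ⊎-↔ fibre τ a
    ; fibre-step = λ where
        Pa (inj₁ x) → cong inj₁ (fibre-step σ Pa x)
        Pa (inj₂ u) → cong inj₂ (fibre-step τ Pa u)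
    }

  twist-⊆ : Q ⊆ P → Twist B P X Y → Twist B Q X Y
  twist-⊆ Q⊆P σ = record { fibre = fibre σ ; fibre-step = fibre-step σ ∘ Q⊆P }

  -- Invariance of Q makes the choice between τ and σ constant along orbits of B.
  twist-select : ∀ {P Q X Y} → Decidable Q → (∀ {a} → Q (step B a) ⇔ Q a) →
                 Twist B P X Y → Twist B Q X Y → Twist B (P ∪ Q) X Y
  twist-select {P} {Q} {X} {Y} Q? Q-invariant σ τ =
    record { fibre = selected ; fibre-step = selected-step }
    where
    selected : State B → State X ↔ State Y
    selected a = if does (Q? a) then fibre τ a else fibre σ a

    selected-step : ∀ {a} → (P ∪ Q) a → ∀ x →
                    to (selected (step B a)) (step X x) ≡ step Y (to (selected a) x)
    selected-step {a} Pa⊎Qa x with Q? a | Q? (step B a)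
    ... | yes Qa | yes _    = fibre-step τ Qa x
    ... | yes Qa | no ¬Qa′  = contradiction (Equivalence.from Q-invariant Qa) ¬Qa′
    ... | no ¬Qa | yes Qa′  = contradiction (Equivalence.to Q-invariant Qa′) ¬Qa
    ... | no ¬Qa | no _     = fibre-step σ (fromInj₁ (λ Qa → contradiction Qa ¬Qa) Pa⊎Qa) x

  twist⇒≃ : ∀ {X Y} → Twist B U X Y → B ×ˢ X ≃ B ×ˢ Y
  twist⇒≃ {X} {Y} σ = mk≃ φ λ (a , x) → cong (step B a ,_) (fibre-step σ tt x)
    where
    φ : (State B × State X) ↔ (State B × State Y)
    φ = mk↔ₛ′ (λ (a , x) → a , to (fibre σ a) x) (λ (a , y) → a , from (fibre σ a) y)
              (λ (a , y) → cong (a ,_) (strictlyInverseˡ (fibre σ a) y))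
              (λ (a , x) → cong (a ,_) (strictlyInverseʳ (fibre σ a) x))

  twist-⊗ : Twist B P ⟦ A ⟧ ⟦ A′ ⟧ → Twist B P ⟦ C ⟧ ⟦ C′ ⟧ → Twist B P ⟦ A ⊗ C ⟧ ⟦ A′ ⊗ C′ ⟧
  twist-⊗ σ τ = twist-≃ ⊗≃×ˢ ⊗≃×ˢ (twist-× σ τ)

  twist-^ : Twist B P ⟦ A ⟧ ⟦ A′ ⟧ → ∀ k → Twist B P ⟦ A ^ k ⟧ ⟦ A′ ^ k ⟧
  twist-^ σ zero    = twist-refl
  twist-^ σ (suc k) = twist-⊗ σ (twist-^ σ k)

twist⇒⊗-≅ : Twist ⟦ A ⟧ U ⟦ C ⟧ ⟦ C′ ⟧ → (A ⊗ C) ≅ (A ⊗ C′)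
twist⇒⊗-≅ σ = ≃⇒≅ (≃-trans ⊗≃×ˢ (≃-trans (twist⇒≃ σ) (≃-sym ⊗≃×ˢ)))

-- Formal differences

-- X ⊖ Y stands for X − Y in the Grothendieck ring of systems.
record Difference : Set₁ where
  constructor _⊖_
  field
    plus minus : System
open Difference

infixl 5 _⊠_

_⊠_ : Difference → Difference → Difference
(X ⊖ Y) ⊠ (W ⊖ W′) = (X ×ˢ W ⊎ˢ Y ×ˢ W′) ⊖ (X ×ˢ W′ ⊎ˢ Y ×ˢ W)

Vanishes : (B : System) → Pred (State B) 0ℓ → Difference → Set
Vanishes B P D = Twist B P (plus D) (minus D)

Separated : Difference → Set
Separated D = HasFixedPoint (plus D) × ¬ HasFixedPoint (minus D)

⊠-vanishes : ∀ {B P Q D E} → Decidable Q → (∀ {a} → Q (step B a) ⇔ Q a) →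
             Vanishes B P D → Vanishes B Q E → Vanishes B (P ∪ Q) (D ⊠ E)
⊠-vanishes {B} {P} {Q} {X ⊖ Y} {W ⊖ W′} Q? Q-invariant σ τ = twist-select Q? Q-invariant over-P over-Q
  where
  over-P : Twist B P (X ×ˢ W ⊎ˢ Y ×ˢ W′) (X ×ˢ W′ ⊎ˢ Y ×ˢ W)
  over-P = twist-trans (twist-⊎ (twist-× σ (twist-refl {X = W})) (twist-× (twist-sym σ) (twist-refl {X = W′})))
                       (≃⇒twist ⊎ˢ-comm)
  over-Q : Twist B Q (X ×ˢ W ⊎ˢ Y ×ˢ W′) (X ×ˢ W′ ⊎ˢ Y ×ˢ W)
  over-Q = twist-⊎ (twist-× (twist-refl {X = X}) τ) (twist-× (twist-refl {X = Y}) (twist-sym τ))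

⊠-separated : ∀ {D E} → Separated D → Separated E → Separated (D ⊠ E)
⊠-separated {X ⊖ Y} {W ⊖ W′} ((x , x-fixed) , ¬Y-fixed) ((w , w-fixed) , ¬W′-fixed) =
  (inj₁ (x , w) , cong inj₁ (cong₂ _,_ x-fixed w-fixed)) , λ where
    (inj₁ (_ , w′) , fixed) → ¬W′-fixed (w′ , ,-injectiveʳ (inj₁-injective fixed))
    (inj₂ (y , _)  , fixed) → ¬Y-fixed (y , ,-injectiveˡ (inj₂-injective fixed))

separated⇒≇ : ∀ {D} → Separated D → ¬ toFDDS (plus D) ≅ toFDDS (minus D)
separated⇒≇ {D} (plus-fixed , ¬minus-fixed) iso =
  ¬minus-fixed (≃-fixedPoint plus≃minus plus-fixed)
  where
  plus≃minus : plus D ≃ minus D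
  plus≃minus = ≃-trans (≃-sym (toFDDS-≃ {plus D})) (≃-trans (≅⇒≃ iso) (toFDDS-≃ {minus D}))

-- Cycles

module _ {p : ℕ} .{{_ : NonZero p}} where

  rotate : ℕ → Fin p → Fin p
  rotate d i = (toℕ i + d) mod p

  toℕ-rotate : ∀ d i → toℕ (rotate d i) ≡ (toℕ i + d) % p
  toℕ-rotate d i = toℕ-fromℕ< (m%n<n (toℕ i + d) p)

  rotate-cong : ∀ {d e} i → d % p ≡ e % p → rotate d i ≡ rotate e i
  rotate-cong {d} {e} i d≡e = toℕ-injective (begin
    toℕ (rotate d i)         ≡⟨ toℕ-rotate d i ⟩
    (toℕ i + d) % p          ≡⟨ %-distribˡ-+ (toℕ i) d p ⟩
    (toℕ i % p + d % p) % p  ≡⟨ cong (λ r → (toℕ i % p + r) % p) d≡e ⟩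
    (toℕ i % p + e % p) % p  ≡⟨ %-distribˡ-+ (toℕ i) e p ⟨
    (toℕ i + e) % p          ≡⟨ toℕ-rotate e i ⟨
    toℕ (rotate e i)         ∎)

  rotate-rotate : ∀ d e i → rotate e (rotate d i) ≡ rotate (d + e) i
  rotate-rotate d e i = toℕ-injective (begin
    toℕ (rotate e (rotate d i))      ≡⟨ toℕ-rotate e (rotate d i) ⟩
    (toℕ (rotate d i) + e) % p       ≡⟨ cong (λ r → (r + e) % p) (toℕ-rotate d i) ⟩
    ((toℕ i + d) % p + e) % p        ≡⟨ %-distribˡ-+ ((toℕ i + d) % p) e p ⟩
    ((toℕ i + d) % p % p + e % p) % p ≡⟨ cong (λ r → (r + e % p) % p) (m%n%n≡m%n (toℕ i + d) p) ⟩
    ((toℕ i + d) % p + e % p) % p    ≡⟨ %-distribˡ-+ (toℕ i + d) e p ⟨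
    (toℕ i + d + e) % p              ≡⟨ cong (_% p) (+-assoc (toℕ i) d e) ⟩
    (toℕ i + (d + e)) % p            ≡⟨ toℕ-rotate (d + e) i ⟨
    toℕ (rotate (d + e) i)           ∎)

  rotate-full-turns : ∀ k i → rotate (k * p) i ≡ i
  rotate-full-turns k i = toℕ-injective (begin
    toℕ (rotate (k * p) i)  ≡⟨ toℕ-rotate (k * p) i ⟩
    (toℕ i + k * p) % p     ≡⟨ [m+kn]%n≡m%n (toℕ i) k p ⟩
    toℕ i % p               ≡⟨ m<n⇒m%n≡m (toℕ<n i) ⟩
    toℕ i                   ∎)

  rotation : ℕ → Fin p ↔ Fin p
  rotation d = mk↔ₛ′ (rotate d) (rotate (d * pred p)) undo-after undo-before
    where
    d+d*pred≡d*p : d + d * pred p ≡ d * p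
    d+d*pred≡d*p = trans (sym (*-suc d (pred p))) (cong (d *_) (suc-pred p))

    undo-after : ∀ i → rotate d (rotate (d * pred p) i) ≡ i
    undo-after i = begin
      rotate d (rotate (d * pred p) i)  ≡⟨ rotate-rotate (d * pred p) d i ⟩
      rotate (d * pred p + d) i         ≡⟨ cong (λ e → rotate e i) (trans (+-comm (d * pred p) d) d+d*pred≡d*p) ⟩
      rotate (d * p) i                  ≡⟨ rotate-full-turns d i ⟩
      i                                 ∎

    undo-before : ∀ i → rotate (d * pred p) (rotate d i) ≡ i
    undo-before i = begin
      rotate (d * pred p) (rotate d i)  ≡⟨ rotate-rotate d (d * pred p) i ⟩
      rotate (d + d * pred p) i         ≡⟨ cong (λ e → rotate e i) d+d*pred≡d*p ⟩
      rotate (d * p) i                  ≡⟨ rotate-full-turns d i ⟩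
      i                                 ∎

cycle : (p : ℕ) .{{_ : NonZero p}} → FDDS
cycle p = fdds p (rotate 1)

fixed : ℕ → FDDS
fixed p = fdds p id

cycle-fixedPoint-free : ∀ m → ¬ HasFixedPoint ⟦ cycle (2 + m) ⟧
cycle-fixedPoint-free m (i , rotated≡i) = Sum.[ 1+i≮p , 1+i≢p ]′ (m≤n⇒m<n∨m≡n (toℕ<n i))
  where
  p = 2 + m

  toℕ-rotated : (toℕ i + 1) % p ≡ toℕ i
  toℕ-rotated = trans (sym (toℕ-rotate 1 i)) (cong toℕ rotated≡i)

  1+i≮p : ¬ suc (toℕ i) < p
  1+i≮p 1+i<p = 1+n≢n (begin
    suc (toℕ i)      ≡⟨ m<n⇒m%n≡m 1+i<p ⟨
    suc (toℕ i) % p  ≡⟨ cong (_% p) (+-comm 1 (toℕ i)) ⟩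
    (toℕ i + 1) % p  ≡⟨ toℕ-rotated ⟩
    toℕ i            ∎)

  1+i≢p : suc (toℕ i) ≢ p
  1+i≢p 1+i≡p = contradiction (trans (cong suc (sym i≡0)) 1+i≡p) λ ()
    where
    i≡0 : toℕ i ≡ 0
    i≡0 = begin
      toℕ i            ≡⟨ toℕ-rotated ⟨
      (toℕ i + 1) % p  ≡⟨ cong (_% p) (trans (+-comm (toℕ i) 1) 1+i≡p) ⟩
      p % p            ≡⟨ n%n≡0 p ⟩
      0                ∎

Δ : ℕ → Difference
Δ m = ⟦ fixed (2 + m) ⟧ ⊖ ⟦ cycle (2 + m) ⟧

Δ-separated : ∀ m → Separated (Δ m)
Δ-separated m = (Fin.zero , refl) , cycle-fixedPoint-free m

-- A morphism from B to the disjoint union of the cycles of length ≥ 2: the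
-- state a sits on the cycle of length 2 + level a, at position phase a
-- (counted backwards, modulo that length).
record Clock (B : System) : Set where
  field
    level       : State B → ℕ
    phase       : State B → ℕ
    bound       : ℕ
    level≤bound : ∀ a → level a ≤ bound
    level-step  : ∀ a → level (step B a) ≡ level a
    phase-step  : ∀ a → suc (phase (step B a)) % (2 + level a) ≡ phase a % (2 + level a)

stage : ℕ → Difference
stage zero    = Δ 0
stage (suc m) = stage m ⊠ Δ (suc m)

stage-separated : ∀ m → Separated (stage m)
stage-separated zero    = Δ-separated 0
stage-separated (suc m) = ⊠-separated {stage m} {Δ (suc m)} (stage-separated m) (Δ-separated (suc m))

module _ {B : System} (clock : Clock B) where
  open Clock clock

  Δ-vanishes : ∀ m → Vanishes B (λ a → level a ≡ m) (Δ m)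
  Δ-vanishes m = twist-sym (record { fibre = rotation ∘ phase ; fibre-step = rotation-step })
    where
    rotation-step : ∀ {a} → level a ≡ m → ∀ i → rotate (phase (step B a)) (rotate 1 i) ≡ rotate {2 + m} (phase a) i
    rotation-step {a} level≡m i = trans (rotate-rotate 1 (phase (step B a)) i) (rotate-cong i phase-step′)
      where
      phase-step′ : suc (phase (step B a)) % (2 + m) ≡ phase a % (2 + m)
      phase-step′ = subst (λ l → suc (phase (step B a)) % (2 + l) ≡ phase a % (2 + l)) level≡m (phase-step a)

  stage-vanishes : ∀ m → Vanishes B (λ a → level a ≤ m) (stage m)
  stage-vanishes zero    = twist-⊆ n≤0⇒n≡0 (Δ-vanishes 0)
  stage-vanishes (suc m) =
    twist-⊆ (Sum.map₁ s≤s⁻¹ ∘ m≤n⇒m<n∨m≡n)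
      (⊠-vanishes (λ a → level a ≟ℕ suc m) level-invariant (stage-vanishes m) (Δ-vanishes (suc m)))
    where
    level-invariant : ∀ {a} → level (step B a) ≡ suc m ⇔ level a ≡ suc m
    level-invariant {a} = mk⇔ (trans (sym (level-step a))) (trans (level-step a))

  clock-vanishes : Vanishes B U (stage bound)
  clock-vanishes = twist-⊆ (λ {a} _ → level≤bound a) (stage-vanishes bound)

-- Iteration in a finite set

module Iteration {n : ℕ} (f : Fin n → Fin n) where

  iter-comm : ∀ t x → f (iter f t x) ≡ iter f t (f x)
  iter-comm zero    x = refl
  iter-comm (suc t) x = cong f (iter-comm t x)

  iter-+ : ∀ s t x → iter f (s + t) x ≡ iter f s (iter f t x)
  iter-+ zero    t x = refl
  iter-+ (suc s) t x = cong f (iter-+ s t x)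

  iter-n-periodic : ∀ x → ∃[ p ] 0 < p × p ≤ n × iter f p (iter f n x) ≡ iter f n x
  iter-n-periodic x with pigeonhole (n<1+n n) (λ k → iter f (toℕ k) x)
  ... | i , j , i<j , fⁱx≡fʲx = toℕ j ∸ toℕ i , m<n⇒0<n∸m i<j , ≤-trans (m∸n≤m (toℕ j) (toℕ i)) (toℕ≤pred[n] j) , periodic
    where
    i≤n : toℕ i ≤ n
    i≤n = ≤-trans (<⇒≤ i<j) (toℕ≤pred[n] j)

    exponents : toℕ j ∸ toℕ i + n ≡ n ∸ toℕ i + toℕ j
    exponents = begin
      toℕ j ∸ toℕ i + n      ≡⟨ +-∸-comm n (<⇒≤ i<j) ⟨
      toℕ j + n ∸ toℕ i      ≡⟨ cong (_∸ toℕ i) (+-comm (toℕ j) n) ⟩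
      n + toℕ j ∸ toℕ i      ≡⟨ +-∸-comm (toℕ j) i≤n ⟩
      n ∸ toℕ i + toℕ j      ∎

    periodic : iter f (toℕ j ∸ toℕ i) (iter f n x) ≡ iter f n x
    periodic = begin
      iter f (toℕ j ∸ toℕ i) (iter f n x)  ≡⟨ iter-+ (toℕ j ∸ toℕ i) n x ⟨
      iter f (toℕ j ∸ toℕ i + n) x         ≡⟨ cong (λ t → iter f t x) exponents ⟩
      iter f (n ∸ toℕ i + toℕ j) x         ≡⟨ iter-+ (n ∸ toℕ i) (toℕ j) x ⟩
      iter f (n ∸ toℕ i) (iter f (toℕ j) x) ≡⟨ cong (iter f (n ∸ toℕ i)) fⁱx≡fʲx ⟨
      iter f (n ∸ toℕ i) (iter f (toℕ i) x) ≡⟨ iter-+ (n ∸ toℕ i) (toℕ i) x ⟨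
      iter f (n ∸ toℕ i + toℕ i) x         ≡⟨ cong (λ t → iter f t x) (m∸n+n≡m i≤n) ⟩
      iter f n x                           ∎

  InOrbit : Fin n → Fin n → Set
  InOrbit c y = ∃[ t ] t < n × y ≡ iter f t c

  orbit : Fin n → List (Fin n)
  orbit c = applyUpTo (λ t → iter f t c) n

  module _ {c p} (1+p≤n : suc p ≤ n) (periodic : iter f (suc p) c ≡ c) where

    InOrbit-step⁺ : ∀ {y} → InOrbit c y → InOrbit (f c) y
    InOrbit-step⁺ (zero  , _   , refl) = p , 1+p≤n , trans (sym periodic) (iter-comm p c)
    InOrbit-step⁺ (suc t , t<n , refl) = t , <⇒≤ t<n , iter-comm t c

    InOrbit-step⁻ : ∀ {y} → InOrbit (f c) y → InOrbit c y
    InOrbit-step⁻ (t , t<n , refl) with m≤n⇒m<n∨m≡n t<n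
    ... | inj₁ 1+t<n = suc t , 1+t<n , sym (iter-comm t c)
    ... | inj₂ 1+t≡n = n ∸ suc p , ∸-monoʳ-< z<s 1+p≤n , (begin
      iter f t (f c)                       ≡⟨ iter-comm t c ⟨
      iter f (suc t) c                     ≡⟨ cong (λ s → iter f s c) 1+t≡n ⟩
      iter f n c                           ≡⟨ cong (λ s → iter f s c) (m∸n+n≡m 1+p≤n) ⟨
      iter f (n ∸ suc p + suc p) c         ≡⟨ iter-+ (n ∸ suc p) (suc p) c ⟩
      iter f (n ∸ suc p) (iter f (suc p) c) ≡⟨ cong (iter f (n ∸ suc p)) periodic ⟩
      iter f (n ∸ suc p) c                 ∎)

  least : Fin n → Fin n
  least c = argmin toℕ c (orbit c)

  least-InOrbit : ∀ c → InOrbit c (least c)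
  least-InOrbit c = argmin-all toℕ {P = InOrbit c} (0 , ≤-<-trans z≤n (toℕ<n c) , refl)
                                   (applyUpTo⁺₁ (λ t → iter f t c) n (λ t<n → _ , t<n , refl))

  least-≤ : ∀ c {y} → InOrbit c y → toℕ (least c) ≤ toℕ y
  least-≤ c (t , t<n , refl) = applyUpTo⁻ (λ t → iter f t c) n (f[argmin]≤f[xs] {f = toℕ} c (orbit c)) t<n

  least-cong : ∀ {c d} → (∀ {y} → InOrbit c y → InOrbit d y) → (∀ {y} → InOrbit d y → InOrbit c y) →
               least c ≡ least d
  least-cong c⊆d d⊆c = toℕ-injective (≤-antisym (least-≤ _ (d⊆c (least-InOrbit _)))
                                                (least-≤ _ (c⊆d (least-InOrbit _))))

  -- The least t ≤ fuel with f^t x ≡ b, provided there is one.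
  time-to : Fin n → ℕ → Fin n → ℕ
  time-to b zero    x = 0
  time-to b (suc m) x with x ≟ b
  ... | yes _ = 0
  ... | no  _ = suc (time-to b m (f x))

  time-to-target : ∀ b m → time-to b m b ≡ 0
  time-to-target b zero = refl
  time-to-target b (suc m) with b ≟ b
  ... | yes _   = refl
  ... | no  b≢b = contradiction refl b≢b

  time-to-step : ∀ {b x} m → x ≢ b → time-to b (suc m) x ≡ suc (time-to b m (f x))
  time-to-step {b} {x} m x≢b with x ≟ b
  ... | yes x≡b = contradiction x≡b x≢b
  ... | no  _   = refl

  time-to-≤ : ∀ b m x → time-to b m x ≤ m
  time-to-≤ b zero    x = z≤n
  time-to-≤ b (suc m) x with x ≟ b
  ... | yes _ = z≤n
  ... | no  _ = s≤s (time-to-≤ b m (f x))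

  time-to-stable : ∀ {b} t m x → iter f t x ≡ b → t ≤ m → time-to b m x ≡ time-to b (suc m) x
  time-to-stable zero    m       x refl _ = trans (time-to-target x m) (sym (time-to-target x (suc m)))
  time-to-stable (suc t) zero    x _    ()
  time-to-stable {b} (suc t) (suc m) x hit (s≤s t≤m) with x ≟ b
  ... | yes _ = refl
  ... | no  _ = cong suc (time-to-stable t m (f x) (trans (sym (iter-comm t x)) hit) t≤m)

module FixedPointFree (A : FDDS) (fixedPoint-free : ¬ HasFixedPoint ⟦ A ⟧) where
  private
    n = size A
    f = fun A
  open Iteration f

  -- f^n a lies on the cycle of the component of a; its point of least index is the root.
  root : Fin n → Fin n
  root a = least (iter f n a)

  root-step : ∀ a → root (f a) ≡ root a
  root-step a with iter-n-periodic a
  ... | suc p , _ , 1+p≤n , periodic = begin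
    least (iter f n (f a))  ≡⟨ cong least (iter-comm n a) ⟨
    least (f (iter f n a))  ≡⟨ least-cong (InOrbit-step⁻ 1+p≤n periodic) (InOrbit-step⁺ 1+p≤n periodic) ⟩
    least (iter f n a)      ∎

  root-reachable : ∀ a → ∃[ t ] t ≤ n + n × iter f t a ≡ root a
  root-reachable a with least-InOrbit (iter f n a)
  ... | t , t<n , root≡ = t + n , +-monoˡ-≤ n (<⇒≤ t<n) , trans (iter-+ t n a) (sym root≡)

  fuel : ℕ
  fuel = n + n

  level : Fin n → ℕ
  level a = time-to (root a) fuel (f (f (root a)))

  phase : Fin n → ℕ
  phase a = time-to (root a) (suc fuel) a

  -- The cycle through root a has length 2 + level a.
  root-return : ∀ a → time-to (root a) (suc fuel) (f (root a)) ≡ suc (level a)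
  root-return a = time-to-step fuel (λ fixed → fixedPoint-free (root a , fixed))

  phase-off-root : ∀ a → a ≢ root a → phase a ≡ suc (phase (f a))
  phase-off-root a a≢root with root-reachable (f a)
  ... | t , t≤fuel , hits = begin
    time-to (root a) (suc fuel) a            ≡⟨ time-to-step fuel a≢root ⟩
    suc (time-to (root a) fuel (f a))        ≡⟨ cong suc (time-to-stable t fuel (f a) (trans hits (root-step a)) t≤fuel) ⟩
    suc (time-to (root a) (suc fuel) (f a))  ≡⟨ cong (λ r → suc (time-to r (suc fuel) (f a))) (root-step a) ⟨
    suc (phase (f a))                        ∎

  phase-step : ∀ a → suc (phase (f a)) % (2 + level a) ≡ phase a % (2 + level a)
  phase-step a = by-cases (a ≟ root a)
    where
    p = 2 + level a

    by-cases : Dec (a ≡ root a) → suc (phase (f a)) % p ≡ phase a % p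
    by-cases (no  a≢root) = cong (_% p) (sym (phase-off-root a a≢root))
    by-cases (yes a≡root) = begin
      suc (phase (f a)) % p                               ≡⟨ cong (λ r → suc (time-to r (suc fuel) (f a)) % p) (root-step a) ⟩
      suc (time-to (root a) (suc fuel) (f a)) % p         ≡⟨ cong (λ x → suc (time-to (root a) (suc fuel) (f x)) % p) a≡root ⟩
      suc (time-to (root a) (suc fuel) (f (root a))) % p  ≡⟨ cong (λ t → suc t % p) (root-return a) ⟩
      p % p                                               ≡⟨ n%n≡0 p ⟩
      0                                                   ≡⟨ cong (_% p) phase≡0 ⟨
      phase a % p                                         ∎
      where
      phase≡0 : phase a ≡ 0
      phase≡0 = trans (cong (time-to (root a) (suc fuel)) a≡root) (time-to-target (root a) (suc fuel))

  clock : Clock ⟦ A ⟧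
  clock = record
    { level       = level
    ; phase       = phase
    ; bound       = fuel
    ; level≤bound = λ a → time-to-≤ (root a) fuel (f (f (root a)))
    ; level-step  = λ a → cong (λ r → time-to r fuel (f (f r))) (root-step a)
    ; phase-step  = phase-step
    }

dendron-free⇒fixedPoint-free : ∀ {A} → ¬ ContainsDendron A → ¬ HasFixedPoint ⟦ A ⟧
dendron-free⇒fixedPoint-free no-dendron (y , fixed) = no-dendron (y , y , (0 , 0 , refl) , fixed)

proposition11 : (A : FDDS) (k : ℕ) → k > 0 → ¬ ContainsDendron A → MonomialNotInjective A k
proposition11 A k _ no-dendron =
  toFDDS (plus D) , toFDDS (minus D) , separated⇒≇ {D} (stage-separated bound) ,
  twist⇒⊗-≅ (twist-^ (twist-≃ toFDDS-≃ toFDDS-≃ (clock-vanishes clock)) k)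
  where
  clock : Clock ⟦ A ⟧
  clock = FixedPointFree.clock A (dendron-free⇒fixedPoint-free no-dendron)
  open Clock clock using (bound)
  D : Difference
  D = stage bound
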